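{- Let $\alpha$ be an ordinal, $\theta$ an infinite ordinal, $\bar a\neq\bar b\in(\theta^{\underline{\alpha}})_<$, and let $J_+$, $R$ and $n_A$ (for $A\in J_+/R$) be as in the context. For every $A\in J_+/R$ there is a strictly increasing sequence $\langle\zeta^A_n\in A:n<n_A\rangle$ such that $a_{\zeta^A_{n+1}}\le b_{\zeta^A_n}$ for every $n$ with $n+1<n_A$, and $b_{\zeta^A_n}<a_{\zeta^A_{n+2}}$ for every $n$ with $n+2<n_A$.
   Context: $(\theta^{\underline\alpha})_<$ is the set of strictly increasing sequences of length $\alpha$ of ordinals below $\theta$. $J_+=\{\beta<\alpha:a_\beta<b_\beta\}$. $R$ is the smallest equivalence relation on $\alpha$ with convex classes containing $\{(\beta,\gamma):a_\beta=b_\gamma\}$, $\{(\beta,\gamma):a_\beta<a_\gamma\le b_\beta\}$ and $\{(\beta,\gamma):b_\beta<b_\gamma\le a_\beta\}$; $J_+/R$ is the set of $R$-classes contained in $J_+$. For $A\in J_+/R$: $\delta^A_0=\min A$; given $\delta^A_n$, if some $\gamma\in A$ satisfies $b_{\delta^A_n}\le a_\gamma$, let $\delta^A_{n+1}$ be the least such, otherwise stop; $n_A\le\omega$ is the length of $\langle\delta^A_n:n<n_A\rangle$. -}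

module Defs where

open import Level using (0ℓ)
open import Data.Nat using (ℕ; zero; suc) renaming (_<_ to _<ℕ_)
open import Data.Fin using (Fin)
open import Data.Product using (Σ; ∃; _×_; _,_)
open import Data.Sum using (_⊎_)
open import Relation.Nullary using (¬_)
open import Relation.Binary.Core using (Rel)
open import Relation.Binary.Structures using (IsStrictTotalOrder)
open import Relation.Binary.PropositionalEquality using (_≡_)
open import Induction.WellFounded using (WellFounded)
open import Function.Bundles using (_↔_)

-- An ordinal, represented (up to isomorphism) by a well-ordered set:
-- a strict total order (w.r.t. propositional equality) that is well-founded.
record Ordinal : Set₁ where
  field
    Carrier : Set
    _<_     : Rel Carrier 0ℓ
    isSTO   : IsStrictTotalOrder _≡_ _<_
    wf      : WellFounded _<_

  _≤_ : Rel Carrier 0ℓ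
  x ≤ y = x < y ⊎ x ≡ y

Infinite : Ordinal → Set
Infinite θ = ¬ Σ ℕ (λ n → Ordinal.Carrier θ ↔ Fin n)

data Len : Set where
  fin : ℕ → Len
  ω   : Len

_<L_ : ℕ → Len → Set
n <L fin k = n <ℕ k
n <L ω     = Data.Unit.⊤
  where import Data.Unit

module Setup (α θ : Ordinal) where
  private
    module A = Ordinal α
    module T = Ordinal θ
  open A using () renaming (Carrier to |α|; _<_ to _<α_; _≤_ to _≤α_)
  open T using () renaming (Carrier to |θ|; _<_ to _<θ_; _≤_ to _≤θ_)

  StrictInc : (|α| → |θ|) → Set
  StrictInc a = ∀ {x y} → x <α y → a x <θ a y

  module Pair (a b : |α| → |θ|) where

    J+ : |α| → Set
    J+ β = a β <θ b β

    Base : |α| → |α| → Set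
    Base β γ = (a β ≡ b γ)
             ⊎ ((a β <θ a γ) × (a γ ≤θ b β))
             ⊎ ((b β <θ b γ) × (b γ ≤θ a β))

    data R : |α| → |α| → Set where
      base   : ∀ {β γ} → Base β γ → R β γ
      refl'  : ∀ {β} → R β β
      sym'   : ∀ {β γ} → R β γ → R γ β
      trans' : ∀ {β γ δ} → R β γ → R γ δ → R β δ
      convex : ∀ {β γ δ} → R β γ → β ≤α δ → δ ≤α γ → R β δ

    -- The R-class of β₀ (A = β₀/R), and the statement that it is contained in J+.
    InClass : |α| → |α| → Set
    InClass β₀ γ = R γ β₀

    ClassInJ+ : |α| → Set
    ClassInJ+ β₀ = ∀ γ → InClass β₀ γ → J+ γ

    -- "δ is the sequence ⟨δ^A_n : n < N⟩ and N = n_A" for the class A = β₀/R.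
    record IsDeltaSeq (β₀ : |α|) (N : Len) (δ : ℕ → |α|) : Set where
      field
        pos       : 0 <L N
        mem       : ∀ n → n <L N → InClass β₀ (δ n)
        first-min : ∀ γ → InClass β₀ γ → δ 0 ≤α γ
        step-ok   : ∀ n → suc n <L N → b (δ n) ≤θ a (δ (suc n))
        step-min  : ∀ n → suc n <L N → ∀ γ → InClass β₀ γ →
                    b (δ n) ≤θ a γ → δ (suc n) ≤α γ
        stop      : ∀ k → N ≡ fin (suc k) →
                    ¬ ∃ (λ γ → InClass β₀ γ × (b (δ k) ≤θ a γ))

-- Inside the class A ⊆ J₊, whenever l < t lie in A some u ∈ [l, t) has a_t ≤ b_u.
-- Otherwise every interval [a_u, b_u] with u < t lies strictly below a_t while every
-- one with u ≥ t reaches above a_t; then no generator of R crosses t, hence neither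
-- does R (equivalence closure and convexity preserve this), contradicting l R t.
-- Build ζ greedily together with floors λ_n: given ζ_n, let μ be the least element of A
-- with b_{ζ_n} < a_μ, pick ζ_{n+1} ∈ [λ_n, μ) with a_μ ≤ b_{ζ_{n+1}}, and put λ_{n+1} = μ.
-- Minimality of μ gives a_{ζ_{n+1}} ≤ b_{ζ_n}, and ζ_{n+2} ≥ λ_{n+1} = μ gives
-- b_{ζ_n} < a_{ζ_{n+2}}. Comparing with δ (ζ_n < δ_{n+1}) shows that μ exists for
-- n + 2 < n_A.
module Submission where

open import Defs
open import Data.Nat using (ℕ; zero; suc) renaming (_<_ to _<ℕ_)
open import Data.Nat.Properties using (<⇒≤; m<1+n⇒m<n∨m≡n)
open import Data.Product using (Σ; _×_; _,_; proj₁; proj₂)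
open import Data.Sum using (inj₁; inj₂)
open import Data.Empty using (⊥-elim)
open import Relation.Nullary using (¬_; yes; no)
open import Relation.Binary.Core using (Rel)
open import Relation.Binary.Definitions using (Transitive; tri<; tri≈; tri>)
open import Relation.Binary.Structures using (IsStrictTotalOrder)
open import Relation.Binary.PropositionalEquality using (_≡_; refl; sym)
open import Induction.WellFounded using (Acc; acc)
open import Axiom.ExcludedMiddle using (ExcludedMiddle)
open import Level using (0ℓ)
open Ordinal using (Carrier)
import Relation.Binary.Construct.StrictToNonStrict as NonStrict
open import Relation.Binary.Bundles using (StrictTotalOrder)
import Relation.Binary.Reasoning.StrictPartialOrder

<L-pred : ∀ {n N} → suc n <L N → n <L N
<L-pred {N = fin k} p = <⇒≤ p
<L-pred {N = ω}     p = p

module _ {A : Set} {_<_ : Rel A 0ℓ} (<-trans : Transitive _<_) where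

  step-increasing⇒increasing : ∀ {N} (f : ℕ → A) → (∀ m → suc m <L N → f m < f (suc m)) →
                               ∀ n m → n <ℕ m → m <L N → f n < f m
  step-increasing⇒increasing f step n (suc m) n<1+m 1+m<N with m<1+n⇒m<n∨m≡n n<1+m
  ... | inj₁ n<m = <-trans (step-increasing⇒increasing f step n m n<m (<L-pred 1+m<N)) (step m 1+m<N)
  ... | inj₂ refl = step n 1+m<N

module OrdinalProperties (O : Ordinal) where
  open Ordinal O hiding (Carrier)
  open IsStrictTotalOrder isSTO public using (_<?_) renaming (trans to <-trans)
  open IsStrictTotalOrder isSTO using (compare; irrefl; <-respʳ-≈; <-respˡ-≈)

  <-irrefl : ∀ {x} → ¬ x < x
  <-irrefl = irrefl refl

  <-≤-trans : ∀ {x y z} → x < y → y ≤ z → x < z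
  <-≤-trans = NonStrict.<-≤-trans _≡_ _<_ <-trans <-respʳ-≈

  ≤-<-trans : ∀ {x y z} → x ≤ y → y < z → x < z
  ≤-<-trans = NonStrict.≤-<-trans _≡_ _<_ sym <-trans <-respˡ-≈

  ≤⇒≯ : ∀ {x y} → x ≤ y → ¬ y < x
  ≤⇒≯ x≤y y<x = <-irrefl (≤-<-trans x≤y y<x)

  ≮⇒≥ : ∀ {x y} → ¬ x < y → y ≤ x
  ≮⇒≥ {x} {y} x≮y with compare x y
  ... | tri< x<y _ _ = ⊥-elim (x≮y x<y)
  ... | tri≈ _ x≡y _ = inj₂ (sym x≡y)
  ... | tri> _ _ y<x = inj₁ y<x

  ≰⇒> : ∀ {x y} → ¬ x ≤ y → y < x
  ≰⇒> {x} {y} x≰y with compare x y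
  ... | tri< x<y _ _ = ⊥-elim (x≰y (inj₁ x<y))
  ... | tri≈ _ x≡y _ = ⊥-elim (x≰y (inj₂ x≡y))
  ... | tri> _ _ y<x = y<x

  strictTotalOrder : StrictTotalOrder 0ℓ 0ℓ 0ℓ
  strictTotalOrder = record { isStrictTotalOrder = isSTO }

  module Reasoning = Relation.Binary.Reasoning.StrictPartialOrder
    (StrictTotalOrder.strictPartialOrder strictTotalOrder)

  least : ExcludedMiddle 0ℓ → (P : Carrier O → Set) → ∀ {x} → P x →
          Σ (Carrier O) λ m → P m × (∀ y → P y → m ≤ y)
  least em P {x} px = go x (wf x) px
    where
      go : ∀ x → Acc _<_ x → P x → Σ (Carrier O) λ m → P m × (∀ y → P y → m ≤ y)
      go x (acc rs) px with em {Σ (Carrier O) λ y → y < x × P y}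
      ... | yes (y , y<x , py) = go y (rs y<x) py
      ... | no none = x , px , λ y py → ≮⇒≥ (λ y<x → none (y , y<x , py))

module StrictlyIncreasing (α θ : Ordinal) {f : Carrier α → Carrier θ}
                          (f-inc : Setup.StrictInc α θ f) where
  private
    module α = OrdinalProperties α
    module θ = OrdinalProperties θ
  open Ordinal α using () renaming (_<_ to _<α_; _≤_ to _≤α_)
  open Ordinal θ using () renaming (_<_ to _<θ_; _≤_ to _≤θ_)

  monotone : ∀ {x y} → x ≤α y → f x ≤θ f y
  monotone (inj₁ x<y)  = inj₁ (f-inc x<y)
  monotone (inj₂ refl) = inj₂ refl

  reflects-< : ∀ {x y} → f x <θ f y → x <α y
  reflects-< fx<fy = α.≰⇒> λ y≤x → θ.≤⇒≯ (monotone y≤x) fx<fy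

module Separation (α θ : Ordinal) (a b : Carrier α → Carrier θ)
                  (a-inc : Setup.StrictInc α θ a) (b-inc : Setup.StrictInc α θ b) where
  open Setup.Pair α θ a b
  open Ordinal α using () renaming (_<_ to _<α_; _≤_ to _≤α_)
  open Ordinal θ using () renaming (_<_ to _<θ_; _≤_ to _≤θ_)
  private
    module α = OrdinalProperties α
    module θ = OrdinalProperties θ
    module a↑ = StrictlyIncreasing α θ a-inc
    module b↑ = StrictlyIncreasing α θ b-inc

  Gap : Carrier α → Set
  Gap t = ∀ u → u <α t → b u <θ a t

  module _ {t} (J+t : J+ t) (gap : Gap t) where
    private
      a-above : ∀ {u} → ¬ u <α t → a t ≤θ a u
      a-above u≮t = a↑.monotone (α.≮⇒≥ u≮t)

      b-above : ∀ {u} → ¬ u <α t → a t <θ b u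
      b-above u≮t = θ.<-≤-trans J+t (b↑.monotone (α.≮⇒≥ u≮t))

    open θ.Reasoning

    ¬Base-upward : ∀ {x y} → x <α t → ¬ y <α t → ¬ Base x y
    ¬Base-upward {x} {y} x<t y≮t (inj₁ ax≡by) = θ.<-irrefl (begin-strict
      a x  <⟨ a-inc x<t ⟩
      a t  <⟨ b-above y≮t ⟩
      b y  ≡⟨ sym ax≡by ⟩
      a x  ∎)
    ¬Base-upward {x} {y} x<t y≮t (inj₂ (inj₁ (_ , ay≤bx))) = θ.<-irrefl (begin-strict
      a t  ≤⟨ a-above y≮t ⟩
      a y  ≤⟨ ay≤bx ⟩
      b x  <⟨ gap x x<t ⟩
      a t  ∎)
    ¬Base-upward {x} {y} x<t y≮t (inj₂ (inj₂ (_ , by≤ax))) = θ.<-irrefl (begin-strict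
      a t  <⟨ b-above y≮t ⟩
      b y  ≤⟨ by≤ax ⟩
      a x  <⟨ a-inc x<t ⟩
      a t  ∎)

    ¬Base-downward : ∀ {x y} → ¬ x <α t → y <α t → ¬ Base x y
    ¬Base-downward {x} {y} x≮t y<t (inj₁ ax≡by) = θ.<-irrefl (begin-strict
      b y  <⟨ gap y y<t ⟩
      a t  ≤⟨ a-above x≮t ⟩
      a x  ≡⟨ ax≡by ⟩
      b y  ∎)
    ¬Base-downward {x} {y} x≮t y<t (inj₂ (inj₁ (ax<ay , _))) = θ.<-irrefl (begin-strict
      a t  ≤⟨ a-above x≮t ⟩
      a x  <⟨ ax<ay ⟩
      a y  <⟨ a-inc y<t ⟩
      a t  ∎)
    ¬Base-downward {x} {y} x≮t y<t (inj₂ (inj₂ (bx<by , _))) = θ.<-irrefl (begin-strict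
      a t  <⟨ b-above x≮t ⟩
      b x  <⟨ bx<by ⟩
      b y  <⟨ gap y y<t ⟩
      a t  ∎)

    R-respects-below : ∀ {x y} → R x y → (x <α t → y <α t) × (y <α t → x <α t)
    R-respects-below {x} {y} (base B) = upward , downward
      where
        upward : x <α t → y <α t
        upward x<t with y α.<? t
        ... | yes y<t = y<t
        ... | no  y≮t = ⊥-elim (¬Base-upward x<t y≮t B)
        downward : y <α t → x <α t
        downward y<t with x α.<? t
        ... | yes x<t = x<t
        ... | no  x≮t = ⊥-elim (¬Base-downward x≮t y<t B)
    R-respects-below refl'        = (λ p → p) , (λ p → p)
    R-respects-below (sym' r)     = proj₂ (R-respects-below r) , proj₁ (R-respects-below r)
    R-respects-below (trans' r s) =
        (λ p → proj₁ (R-respects-below s) (proj₁ (R-respects-below r) p))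
      , (λ p → proj₂ (R-respects-below r) (proj₂ (R-respects-below s) p))
    R-respects-below (convex r β≤δ δ≤γ) =
        (λ β<t → α.≤-<-trans δ≤γ (proj₁ (R-respects-below r) β<t))
      , (λ δ<t → α.≤-<-trans β≤δ δ<t)

  straddle : ExcludedMiddle 0ℓ → ∀ {l t} → R l t → l <α t → J+ t →
             Σ (Carrier α) λ u → l ≤α u × u <α t × a t ≤θ b u
  straddle em {l} {t} Rlt l<t J+t with em {Σ (Carrier α) λ u → l ≤α u × u <α t × a t ≤θ b u}
  ... | yes found = found
  ... | no none = ⊥-elim (α.<-irrefl (proj₁ (R-respects-below J+t gap Rlt) l<t))
    where
      b<a : ∀ {u} → l ≤α u → u <α t → b u <θ a t
      b<a {u} l≤u u<t = θ.≰⇒> λ at≤bu → none (u , l≤u , u<t , at≤bu)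
      gap : Gap t
      gap u u<t with u α.<? l
      ... | yes u<l = θ.<-trans (b-inc u<l) (b<a (inj₂ refl) l<t)
      ... | no  u≮l = b<a (α.≮⇒≥ u≮l) u<t

module Construction (em : ExcludedMiddle 0ℓ) (α θ : Ordinal) (a b : Carrier α → Carrier θ)
                    (a-inc : Setup.StrictInc α θ a) (b-inc : Setup.StrictInc α θ b)
                    (β₀ : Carrier α) (A⊆J+ : Setup.Pair.ClassInJ+ α θ a b β₀) where
  open Setup.Pair α θ a b
  open Ordinal α using () renaming (_<_ to _<α_; _≤_ to _≤α_)
  open Ordinal θ using () renaming (_<_ to _<θ_; _≤_ to _≤θ_)
  open Separation α θ a b a-inc b-inc using (straddle)
  private
    module α = OrdinalProperties α
    module θ = OrdinalProperties θ
    module a↑ = StrictlyIncreasing α θ a-inc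
    module b↑ = StrictlyIncreasing α θ b-inc

  A : Carrier α → Set
  A = InClass β₀

  straddle-in-A : ∀ {l t} → A l → A t → l <α t →
                  Σ (Carrier α) λ u → A u × l ≤α u × u <α t × a t ≤θ b u
  straddle-in-A {l} {t} l∈A t∈A l<t with straddle em (trans' l∈A (sym' t∈A)) l<t (A⊆J+ t t∈A)
  ... | u , l≤u , u<t , at≤bu = u , u∈A , l≤u , u<t , at≤bu
    where
      u∈A : A u
      u∈A = trans' (base (inj₂ (inj₁ (a-inc u<t , at≤bu)))) t∈A

  record Config : Set where
    constructor config
    field
      cur floor     : Carrier α
      cur∈A         : A cur
      floor∈A       : A floor
      a-floor≤b-cur : a floor ≤θ b cur
  open Config public

  Above : Carrier θ → Carrier α → Set
  Above c u = A u × c <θ a u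

  Reaches : Config → Set
  Reaches s = Σ (Carrier α) (Above (b (cur s)))

  Continues : Config → Set
  Continues s = Σ (Carrier α) λ t → A t × cur s <α t × floor s ≤α t

  Extends : Config → Config → Set
  Extends s s′ = cur s <α cur s′ × a (cur s′) ≤θ b (cur s) × floor s ≤α cur s′

  JumpsOver : Config → Config → Set
  JumpsOver s s′ = b (cur s) <θ a (floor s′) × cur s′ <α floor s′
                 × (∀ t → Above (b (cur s)) t → floor s′ ≤α t)

  jump : (s : Config) → Reaches s → Σ Config λ s′ → Extends s s′ × JumpsOver s s′
  jump (config z l _ l∈A al≤bz) (_ , t-above) with α.least em (Above (b z)) t-above
  ... | m , (m∈A , bz<am) , m-least
    with straddle-in-A l∈A m∈A (a↑.reflects-< (θ.≤-<-trans al≤bz bz<am))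
  ... | g , g∈A , l≤g , g<m , am≤bg =
    config g m g∈A m∈A am≤bg , (z<g , ag≤bz , l≤g) , bz<am , g<m , m-least
    where
      z<g : z <α g
      z<g = b↑.reflects-< (θ.<-≤-trans bz<am am≤bg)
      ag≤bz : a g ≤θ b z
      ag≤bz = θ.≮⇒≥ λ bz<ag → α.≤⇒≯ (m-least g (g∈A , bz<ag)) g<m

  continue : (s : Config) → ¬ Reaches s → Continues s → Σ Config (Extends s)
  continue s unreached (t , t∈A , z<t , l≤t) =
    config t t t∈A t∈A (inj₁ (A⊆J+ t t∈A)) , z<t , θ.≮⇒≥ (λ bz<at → unreached (t , t∈A , bz<at)) , l≤t

  next : Config → Config
  next s with em {Reaches s}
  ... | yes r = proj₁ (jump s r)
  ... | no ¬r with em {Continues s}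
  ...   | yes c = proj₁ (continue s ¬r c)
  ...   | no _  = s   -- only happens past the end of the chain

  next-jumps : ∀ s → Reaches s → JumpsOver s (next s)
  next-jumps s r with em {Reaches s}
  ... | yes r′ = proj₂ (proj₂ (jump s r′))
  ... | no ¬r  = ⊥-elim (¬r r)

  next-extends : ∀ s → Continues s → Extends s (next s)
  next-extends s c with em {Reaches s}
  ... | yes r = proj₁ (proj₂ (jump s r))
  ... | no ¬r with em {Continues s}
  ...   | yes c′ = proj₂ (continue s ¬r c′)
  ...   | no ¬c  = ⊥-elim (¬c c)

module Chain (em : ExcludedMiddle 0ℓ) (α θ : Ordinal) (a b : Carrier α → Carrier θ)
             (a-inc : Setup.StrictInc α θ a) (b-inc : Setup.StrictInc α θ b)
             (β₀ : Carrier α) (A⊆J+ : Setup.Pair.ClassInJ+ α θ a b β₀)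
             (N : Len) (δ : ℕ → Carrier α) (δ-seq : Setup.Pair.IsDeltaSeq α θ a b β₀ N δ) where
  open Setup.Pair α θ a b using (module IsDeltaSeq)
  open IsDeltaSeq δ-seq
  open Ordinal α using () renaming (_<_ to _<α_; _≤_ to _≤α_)
  open Ordinal θ using () renaming (_<_ to _<θ_)
  open Construction em α θ a b a-inc b-inc β₀ A⊆J+ public
  private
    module α = OrdinalProperties α
    module θ = OrdinalProperties θ
    module a↑ = StrictlyIncreasing α θ a-inc

  δ₀∈A : A (δ 0)
  δ₀∈A = mem 0 pos

  configs : ℕ → Config
  configs zero    = config (δ 0) (δ 0) δ₀∈A δ₀∈A (inj₁ (A⊆J+ (δ 0) δ₀∈A))
  configs (suc n) = next (configs n)

  ζ : ℕ → Carrier α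
  ζ n = cur (configs n)

  below-δ : ∀ k → suc k <L N → ζ k <α δ (suc k) × floor (configs k) ≤α δ (suc k)
  b-ζ<a-δ : ∀ k → suc (suc k) <L N → b (ζ k) <θ a (δ (suc (suc k)))

  reaches : ∀ k → suc (suc k) <L N → Reaches (configs k)
  reaches k 2+k<N = δ (suc (suc k)) , mem _ 2+k<N , b-ζ<a-δ k 2+k<N

  below-δ zero 1<N = δ₀<δ₁ , inj₁ δ₀<δ₁
    where
      δ₀<δ₁ : δ 0 <α δ 1
      δ₀<δ₁ = a↑.reflects-< (θ.<-≤-trans (A⊆J+ (δ 0) δ₀∈A) (step-ok 0 1<N))
  below-δ (suc k) 2+k<N = α.<-≤-trans ζ<floor floor≤δ , floor≤δ
    where
      floor≤δ : floor (configs (suc k)) ≤α δ (suc (suc k))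
      floor≤δ = proj₂ (proj₂ (next-jumps (configs k) (reaches k 2+k<N))) _
                      (mem _ 2+k<N , b-ζ<a-δ k 2+k<N)
      ζ<floor : ζ (suc k) <α floor (configs (suc k))
      ζ<floor = proj₁ (proj₂ (next-jumps (configs k) (reaches k 2+k<N)))

  b-ζ<a-δ k 2+k<N =
    θ.<-≤-trans (b-inc (proj₁ (below-δ k (<L-pred 2+k<N)))) (step-ok (suc k) 2+k<N)

  extends : ∀ k → suc k <L N → Extends (configs k) (configs (suc k))
  extends k 1+k<N = next-extends (configs k) (δ (suc k) , mem _ 1+k<N , below-δ k 1+k<N)

  ζ-increasing : ∀ n m → n <ℕ m → m <L N → ζ n <α ζ m
  ζ-increasing = step-increasing⇒increasing {_<_ = _<α_} α.<-trans ζ (λ m p → proj₁ (extends m p))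

  b<a-two-later : ∀ n → suc (suc n) <L N → b (ζ n) <θ a (ζ (suc (suc n)))
  b<a-two-later n 2+n<N =
    θ.<-≤-trans (proj₁ (next-jumps (configs n) (reaches n 2+n<N)))
                (a↑.monotone (proj₂ (proj₂ (extends (suc n) 2+n<N))))

lemma4p12 : ExcludedMiddle 0ℓ →
    (α θ : Ordinal) → Infinite θ →
    (a b : Carrier α → Carrier θ) →
    Setup.StrictInc α θ a → Setup.StrictInc α θ b →
    ¬ (∀ x → a x ≡ b x) →
    (β₀ : Carrier α) → Setup.Pair.ClassInJ+ α θ a b β₀ →
    (N : Len) (δ : ℕ → Carrier α) → Setup.Pair.IsDeltaSeq α θ a b β₀ N δ →
    Σ (ℕ → Carrier α) λ ζ →
    (∀ n → n <L N → Setup.Pair.InClass α θ a b β₀ (ζ n))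
    × (∀ n m → n <ℕ m → m <L N → Ordinal._<_ α (ζ n) (ζ m))
    × (∀ n → suc n <L N → Ordinal._≤_ θ (a (ζ (suc n))) (b (ζ n)))
    × (∀ n → suc (suc n) <L N → Ordinal._<_ θ (b (ζ n)) (a (ζ (suc (suc n)))))
lemma4p12 em α θ _ a b a-inc b-inc _ β₀ A⊆J+ N δ δ-seq =
    ζ
  , (λ n _ → cur∈A (configs n))
  , ζ-increasing
  , (λ n p → proj₁ (proj₂ (extends n p)))
  , b<a-two-later
  where open Chain em α θ a b a-inc b-inc β₀ A⊆J+ N δ δ-seq
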